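{- Let $G=(V,E)$ be a graph and let $F$ be a set of non-edges of $G$ (pairs of vertices of $V$ not in $E$). Let $G^+$ be obtained from $G$ by adding $F$ as edges. Then $\nu(G^+)\le\nu(G)+\tau(F)$. Moreover, if $\nu(G^+)=\nu(G)+\tau(F)$ and $T$ is a cover for $F$ with $|T|=\tau(F)$, then every maximum matching of $G^+$ covers every vertex of $T$.
   Context: $\nu(H)$ is the matching number of a graph $H$ (size of a maximum matching). For a set $F$ of vertex pairs, a cover for $F$ is a set $T$ of vertices with $T\cap e\ne\varnothing$ for every $e\in F$, and $\tau(F)$ is the minimum size of a cover for $F$. -}

module Defs where

open import Data.Nat using (ℕ; _≤_)
open import Data.Fin using (Fin)
open import Data.Fin.Subset using (Subset; _∈_; ∣_∣)
open import Data.List using (List; length; concatMap; []; _∷_)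
open import Data.List.Relation.Unary.All using (All)
open import Data.List.Relation.Unary.Unique.Propositional using (Unique)
open import Data.List.Membership.Propositional renaming (_∈_ to _∈ₗ_)
open import Data.Product using (Σ; _×_; _,_; proj₁; proj₂)
open import Data.Sum using (_⊎_; inj₁; inj₂)
open import Relation.Nullary using (¬_)
open import Relation.Binary.PropositionalEquality using (_≡_; _≢_; refl)

record Graph (n : ℕ) : Set₁ where
  field
    Adj    : Fin n → Fin n → Set
    sym    : ∀ {u v} → Adj u v → Adj v u
    irrefl : ∀ {u} → ¬ Adj u u
open Graph public

record NonEdges {n : ℕ} (G : Graph n) : Set₁ where
  field
    Pair     : Fin n → Fin n → Set
    pairSym  : ∀ {u v} → Pair u v → Pair v u
    distinct : ∀ {u v} → Pair u v → u ≢ v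
    nonEdge  : ∀ {u v} → Pair u v → ¬ Adj G u v
open NonEdges public

G⁺ : ∀ {n} {G : Graph n} → NonEdges G → Graph n
G⁺ {G = G} F = record
  { Adj    = λ u v → Adj G u v ⊎ Pair F u v
  ; sym    = λ { (inj₁ e) → inj₁ (sym G e) ; (inj₂ p) → inj₂ (pairSym F p) }
  ; irrefl = λ { (inj₁ e) → irrefl G e ; (inj₂ p) → distinct F p refl }
  }

endpoints : ∀ {n} → List (Fin n × Fin n) → List (Fin n)
endpoints = concatMap (λ e → proj₁ e ∷ proj₂ e ∷ [])

IsMatching : ∀ {n} → Graph n → List (Fin n × Fin n) → Set
IsMatching G M = All (λ e → Adj G (proj₁ e) (proj₂ e)) M × Unique (endpoints M)

IsMaximumMatching : ∀ {n} → Graph n → List (Fin n × Fin n) → Set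
IsMaximumMatching G M =
  IsMatching G M × (∀ M′ → IsMatching G M′ → length M′ ≤ length M)

MatchingNumber : ∀ {n} → Graph n → ℕ → Set
MatchingNumber G k = Σ _ λ M → IsMaximumMatching G M × length M ≡ k

IsCover : ∀ {n} {G : Graph n} → NonEdges G → Subset n → Set
IsCover F T = ∀ u v → Pair F u v → u ∈ T ⊎ v ∈ T

CoverNumber : ∀ {n} {G : Graph n} → NonEdges G → ℕ → Set
CoverNumber {n} F t =
  Σ (Subset n) λ T → IsCover F T × (∀ T′ → IsCover F T′ → ∣ T ∣ ≤ ∣ T′ ∣) × ∣ T ∣ ≡ t

CoversVertex : ∀ {n} → List (Fin n × Fin n) → Fin n → Set
CoversVertex M x = x ∈ₗ endpoints M

-- Split a matching M of G⁺ into its G-edges and its F-edges. The G-edges form a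
-- matching of G, so there are at most ν(G) of them. Every F-edge of M contains a
-- vertex of a cover T, and these vertices are distinct because M is a matching,
-- so there are at most |T| F-edges. If some x ∈ T is missed by M, then T - x still
-- covers the F-edges of M, and the same count gives |M| ≤ ν(G) + |T| - 1; for a
-- maximum matching of G⁺ with ν(G⁺) = ν(G) + τ(F) and |T| = τ(F) this is impossible.
module Submission where

open import Defs hiding (sym)
open import Data.Nat using (ℕ; suc; _≤_; _+_; z≤n; s≤s)
open import Data.Nat.Properties using (≤-trans; +-mono-≤; +-monoʳ-<; +-suc; <-irrefl; module ≤-Reasoning)
open import Data.Fin using (Fin; _≟_)
open import Data.Fin.Subset using (Subset; _∈_; _-_; ∣_∣)
open import Data.Fin.Subset.Properties using (x∈p∧x≢y⇒x∈p-y; x∈p⇒∣p-x∣<∣p∣)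
open import Data.List using (List; []; _∷_; length)
open import Data.List.Relation.Unary.All using (All; []; _∷_)
open import Data.List.Relation.Unary.All.Properties using (¬Any⇒All¬)
open import Data.List.Relation.Unary.AllPairs using (_∷_)
open import Data.List.Relation.Unary.Unique.Propositional using (Unique)
open import Data.List.Relation.Unary.Any using (any?)
open import Data.Product using (_×_; _,_; proj₁; proj₂)
open import Data.Sum using (_⊎_; inj₁; inj₂; [_,_]′; map)
open import Relation.Nullary.Decidable using (decidable-stable)
open import Relation.Binary.PropositionalEquality using (_≡_; _≢_; refl; sym; trans; cong; ≢-sym)

Edge : ℕ → Set
Edge n = Fin n × Fin n

maximumMatching-bound : ∀ {n} {G : Graph n} {ν} → MatchingNumber G ν
  → ∀ M → IsMatching G M → length M ≤ ν
maximumMatching-bound (_ , (_ , maximal) , refl) = maximal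

module _ {n} {G : Graph n} (F : NonEdges G) where

  G-edges : (M : List (Edge n)) → All (λ e → Adj (G⁺ F) (proj₁ e) (proj₂ e)) M → List (Edge n)
  G-edges []      []             = []
  G-edges (e ∷ M) (inj₁ _ ∷ adj) = e ∷ G-edges M adj
  G-edges (e ∷ M) (inj₂ _ ∷ adj) = G-edges M adj

  #F-edges : (M : List (Edge n)) → All (λ e → Adj (G⁺ F) (proj₁ e) (proj₂ e)) M → ℕ
  #F-edges []      []             = 0
  #F-edges (e ∷ M) (inj₁ _ ∷ adj) = #F-edges M adj
  #F-edges (e ∷ M) (inj₂ _ ∷ adj) = suc (#F-edges M adj)

  length≡#G-edges+#F-edges : ∀ M adj → length M ≡ length (G-edges M adj) + #F-edges M adj
  length≡#G-edges+#F-edges []      []             = refl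
  length≡#G-edges+#F-edges (e ∷ M) (inj₁ _ ∷ adj) = cong suc (length≡#G-edges+#F-edges M adj)
  length≡#G-edges+#F-edges (e ∷ M) (inj₂ _ ∷ adj) =
    trans (cong suc (length≡#G-edges+#F-edges M adj)) (sym (+-suc _ _))

  G-edges-isMatching : ∀ M → (m : IsMatching (G⁺ F) M) → IsMatching G (G-edges M (proj₁ m))
  G-edges-isMatching M (adj , unique) = adjacent M adj , disjoint M adj unique
    where
    adjacent : ∀ M adj → All (λ e → Adj G (proj₁ e) (proj₂ e)) (G-edges M adj)
    adjacent []      []             = []
    adjacent (e ∷ M) (inj₁ a ∷ adj) = a ∷ adjacent M adj
    adjacent (e ∷ M) (inj₂ _ ∷ adj) = adjacent M adj

    restrict : ∀ {P : Fin n → Set} M adj → All P (endpoints M) → All P (endpoints (G-edges M adj))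
    restrict []      []             ps             = ps
    restrict (e ∷ M) (inj₁ _ ∷ adj) (pu ∷ pv ∷ ps) = pu ∷ pv ∷ restrict M adj ps
    restrict (e ∷ M) (inj₂ _ ∷ adj) (_ ∷ _ ∷ ps)   = restrict M adj ps

    -- Unique (u ∷ v ∷ es) unfolds to (u ≢ v, u ∉ es) ∷ (v ∉ es) ∷ Unique es.
    disjoint : ∀ M adj → Unique (endpoints M) → Unique (endpoints (G-edges M adj))
    disjoint []      []             u = u
    disjoint (e ∷ M) (inj₁ _ ∷ adj) ((u≢v ∷ u∉) ∷ v∉ ∷ u) =
      (u≢v ∷ restrict M adj u∉) ∷ restrict M adj v∉ ∷ disjoint M adj u
    disjoint (e ∷ M) (inj₂ _ ∷ adj) (_ ∷ _ ∷ u) = disjoint M adj u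

  CoversF-edge : Subset n → Edge n → Set
  CoversF-edge T (u , v) = Pair F u v → u ∈ T ⊎ v ∈ T

  cover⇒coversF-edges : ∀ {T} → IsCover F T → ∀ M → All (CoversF-edge T) M
  cover⇒coversF-edges cover []            = []
  cover⇒coversF-edges cover ((u , v) ∷ M) = cover u v ∷ cover⇒coversF-edges cover M

  coversF-edges-remove : ∀ {T x} M → All (x ≢_) (endpoints M)
    → All (CoversF-edge T) M → All (CoversF-edge (T - x)) M
  coversF-edges-remove []      _                []       = []
  coversF-edges-remove (e ∷ M) (x≢u ∷ x≢v ∷ x∉) (c ∷ cs) =
    (λ p → map (λ u∈T → x∈p∧x≢y⇒x∈p-y u∈T (≢-sym x≢u))
               (λ v∈T → x∈p∧x≢y⇒x∈p-y v∈T (≢-sym x≢v)) (c p))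
    ∷ coversF-edges-remove M x∉ cs

  -- Each F-edge spends a vertex of T; as that vertex avoids the rest of M, it can
  -- be deleted from T before counting the remaining F-edges.
  #F-edges≤∣cover∣ : ∀ M adj T → Unique (endpoints M) → All (CoversF-edge T) M → #F-edges M adj ≤ ∣ T ∣
  #F-edges≤∣cover∣ []      []             T _             _        = z≤n
  #F-edges≤∣cover∣ (e ∷ M) (inj₁ _ ∷ adj) T (_ ∷ _ ∷ u)   (_ ∷ cs) = #F-edges≤∣cover∣ M adj T u cs
  #F-edges≤∣cover∣ (e ∷ M) (inj₂ p ∷ adj) T ((_ ∷ u∉) ∷ v∉ ∷ u) (c ∷ cs) =
    [ (λ u∈T → spend u∈T u∉) , (λ v∈T → spend v∈T v∉) ]′ (c p)
    where
    spend : ∀ {x} → x ∈ T → All (x ≢_) (endpoints M) → suc (#F-edges M adj) ≤ ∣ T ∣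
    spend {x} x∈T x∉ =
      ≤-trans (s≤s (#F-edges≤∣cover∣ M adj (T - x) u (coversF-edges-remove M x∉ cs)))
              (x∈p⇒∣p-x∣<∣p∣ x∈T)

  matching⁺-bound : ∀ {ν} → MatchingNumber G ν → ∀ M → IsMatching (G⁺ F) M
    → ∀ T → All (CoversF-edge T) M → length M ≤ ν + ∣ T ∣
  matching⁺-bound {ν} νG M m@(adj , unique) T cs = begin
    length M
      ≡⟨ length≡#G-edges+#F-edges M adj ⟩
    length (G-edges M adj) + #F-edges M adj
      ≤⟨ +-mono-≤ (maximumMatching-bound {G = G} νG (G-edges M adj) (G-edges-isMatching M m))
                  (#F-edges≤∣cover∣ M adj T unique cs) ⟩
    ν + ∣ T ∣
      ∎
    where open ≤-Reasoning

lemma2p3 : ∀ {n} (G : Graph n) (F : NonEdges G) (ν ν⁺ τ : ℕ)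
    → MatchingNumber G ν → MatchingNumber (G⁺ F) ν⁺ → CoverNumber F τ
    → (ν⁺ ≤ ν + τ)
    × (ν⁺ ≡ ν + τ → ∀ T → IsCover F T → ∣ T ∣ ≡ τ
    → ∀ M → IsMaximumMatching (G⁺ F) M → ∀ x → x ∈ T → CoversVertex M x)
lemma2p3 G F ν ν⁺ τ νG (M⁺ , (m⁺ , _) , refl) (T₀ , cover₀ , _ , refl) = bound , saturates
  where
  bound : length M⁺ ≤ ν + ∣ T₀ ∣
  bound = matching⁺-bound F νG M⁺ m⁺ T₀ (cover⇒coversF-edges F cover₀ M⁺)

  saturates : length M⁺ ≡ ν + ∣ T₀ ∣ → ∀ T → IsCover F T → ∣ T ∣ ≡ ∣ T₀ ∣
    → ∀ M → IsMaximumMatching (G⁺ F) M → ∀ x → x ∈ T → CoversVertex M x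
  saturates tight T cover ∣T∣≡τ M (m , maximal) x x∈T =
    decidable-stable (any? (x ≟_) (endpoints M)) λ x∉M → <-irrefl refl (begin-strict
      ν + ∣ T₀ ∣   ≡⟨ sym tight ⟩
      length M⁺    ≤⟨ maximal M⁺ m⁺ ⟩
      length M     ≤⟨ matching⁺-bound F νG M m (T - x)
                        (coversF-edges-remove F M (¬Any⇒All¬ (endpoints M) x∉M)
                                                  (cover⇒coversF-edges F cover M)) ⟩
      ν + ∣ T - x ∣ <⟨ +-monoʳ-< ν (x∈p⇒∣p-x∣<∣p∣ x∈T) ⟩
      ν + ∣ T ∣    ≡⟨ cong (ν +_) ∣T∣≡τ ⟩
      ν + ∣ T₀ ∣   ∎)
    where open ≤-Reasoning
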